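{- Let $k, b, s$ be positive integers, $k,s\ge 2$, $n = ks$, with $n$ sufficiently large relative to $k$ and $b$. Let $\mathcal{F}$ be a family of $k$-element subsets of $[n]$ with $|\mathcal{F}| > |\mathcal{E}(k, n, b)|$, and let $B$ be a blocking set of $\mathcal{F}$ with $|B| \le s/2$. Then there is no matching in $\mathcal{F}$ (of any size) that covers $B$.
   Context: A matching in $\mathcal{F}$ is a collection of pairwise disjoint sets of $\mathcal{F}$; it covers $B$ if every element of $B$ lies in some set of the matching. A blocking set of $\mathcal{F}$ is a set $B \subseteq [n]$ with $|B| \le s$ that cannot be covered by a matching in $\mathcal{F}$ consisting of $|B|$ sets. $\mathcal{E}(k,n,b)$ is defined as follows. Let $E_1, \dots, E_{b-1}$ be pairwise disjoint $(k-1)$-subsets of $[b+1,n]$. For $1 \le i \le b$ let $\mathcal{E}_i = \{\{i\} \cup E_i\} \cup \{\{i\} \cup S: S \subset [b+1,n],\ |S| = k-1,\ S \cap (E_1 \cup \dots \cup E_{i-1}) \neq \emptyset\}$, where for $i=b$ the set $\{b\}\cup E_b$ is omitted. Then $\mathcal{E}(k, n, b) = \{T \subseteq [b+1, n]: |T| = k\} \cup \bigcup_{i=1}^b \mathcal{E}_i$; its size does not depend on the choice of the $E_i$. -}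

module Defs where

open import Data.Bool using (Bool; true; false; _∧_)
open import Data.Nat using (ℕ; zero; suc; _+_; _*_; _∸_; _≤_; _<_; _≤ᵇ_; _<ᵇ_)
import Data.Nat.Properties as ℕP
open import Data.Fin using (Fin; toℕ)
open import Data.Fin.Properties using (any?)
open import Data.Fin.Subset
  using (Subset; inside; outside; _∈_; _⊆_; _∩_; _-_; ⋃; ∣_∣; Nonempty; Empty)
open import Data.Fin.Subset.Properties using (_∈?_; _⊆?_; nonempty?)
open import Data.Vec using (Vec; []; _∷_; tabulate)
import Data.Vec.Properties as VecP
import Data.Bool.Properties as BoolP
open import Data.List using (List; []; _∷_; [_]; map; _++_; filter; length)
open import Data.List.Relation.Unary.All using (All)
open import Data.List.Relation.Unary.AllPairs using (AllPairs)
open import Data.List.Membership.Propositional renaming (_∈_ to _∈ₗ_)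
open import Data.Product using (Σ; ∃; _×_; _,_)
open import Data.Sum using (_⊎_)
open import Relation.Nullary using (¬_; Dec)
open import Relation.Nullary.Decidable using (_×-dec_; _⊎-dec_)
open import Relation.Binary.PropositionalEquality using (_≡_)

-- The ground set [n] = {1,…,n} is represented by Fin n,
-- the element j ∈ [n] being the Fin with toℕ = j - 1.  Subsets of [n]
-- are stdlib 'Subset n' (characteristic vectors), families of subsets
-- are lists of subsets (duplicate-freeness imposed where needed).

allSubsets : (n : ℕ) → List (Subset n)
allSubsets zero    = [ [] ]
allSubsets (suc n) = map (outside ∷_) (allSubsets n) ++ map (inside ∷_) (allSubsets n)

-- Interval lo hi = { x : lo ≤ toℕ x < hi }  (0-based indices),
-- i.e. the 1-based integer interval [lo+1, hi] intersected with [n].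
Interval : {n : ℕ} → ℕ → ℕ → Subset n
Interval lo hi = tabulate (λ x → (lo ≤ᵇ toℕ x) ∧ (toℕ x <ᵇ hi))

-- The extremal family 𝓔(k,n,b), with the concrete choice
--   E_j = [b + (j-1)(k-1) + 1 , b + j(k-1)]   (1-based, 1 ≤ j ≤ b-1),
-- consecutive pairwise disjoint (k-1)-subsets of [b+1,n] (for n large).
-- A 0-based index i : Fin n with toℕ i < b stands for the element i+1 of [1,b].

module ExtremalFamily (k n b : ℕ) where

  Upper : Subset n
  Upper = Interval b n

  Eblock : Fin n → Subset n
  Eblock i = Interval (b + toℕ i * (k ∸ 1)) (b + suc (toℕ i) * (k ∸ 1))

  Ebefore : Fin n → Subset n
  Ebefore i = Interval b (b + toℕ i * (k ∸ 1))

  -- T ∈ 𝓔_{i+1}: T = {i+1} ∪ S with S ⊆ [b+1,n], |S| = k-1 and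
  -- (S = E_{i+1} and i+1 < b) or S ∩ (E_1 ∪ … ∪ E_i) ≠ ∅.
  -- (Since i+1 ∉ [b+1,n], S is necessarily T minus {i+1}.)
  InEi : Fin n → Subset n → Set
  InEi i T = toℕ i < b × i ∈ T × (T - i) ⊆ Upper × ∣ T - i ∣ ≡ k ∸ 1
           × ((suc (toℕ i) < b × (T - i) ≡ Eblock i) ⊎ Nonempty ((T - i) ∩ Ebefore i))

  InE : Subset n → Set
  InE T = (T ⊆ Upper × ∣ T ∣ ≡ k) ⊎ Σ (Fin n) (λ i → InEi i T)

  InEi? : ∀ i T → Dec (InEi i T)
  InEi? i T = (toℕ i ℕP.<? b) ×-dec ((i ∈? T) ×-dec (((T - i) ⊆? Upper) ×-dec
              ((∣ T - i ∣ ℕP.≟ (k ∸ 1)) ×-dec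
              (((suc (toℕ i) ℕP.<? b) ×-dec VecP.≡-dec BoolP._≟_ (T - i) (Eblock i))
                ⊎-dec nonempty? ((T - i) ∩ Ebefore i)))))

  InE? : ∀ T → Dec (InE T)
  InE? T = ((T ⊆? Upper) ×-dec (∣ T ∣ ℕP.≟ k)) ⊎-dec any? (λ i → InEi? i T)

Ecard : ℕ → ℕ → ℕ → ℕ
Ecard k n b = length (filter (ExtremalFamily.InE? k n b) (allSubsets n))

Disjoint : {n : ℕ} → Subset n → Subset n → Set
Disjoint A C = Empty (A ∩ C)

-- M is a matching in 𝓕: a list of pairwise disjoint members of 𝓕.
-- (Members are k-sets with k ≥ 1, hence nonempty, so pairwise
-- disjointness forces the entries of M to be distinct; |M| = length M.)
IsMatching : {n : ℕ} → List (Subset n) → List (Subset n) → Set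
IsMatching F M = All (_∈ₗ F) M × AllPairs Disjoint M

Covers : {n : ℕ} → List (Subset n) → Subset n → Set
Covers M B = B ⊆ ⋃ M

Blocking : {n : ℕ} → ℕ → List (Subset n) → Subset n → Set
Blocking s F B = ∣ B ∣ ≤ s ×
  ¬ (∃ λ M → IsMatching F M × length M ≡ ∣ B ∣ × Covers M B)

module Submission where

-- Suppose a matching covers B.  Dropping the sets that miss B leaves a covering matching of at
-- most |B| sets.  Put q = s - |B| ≥ s/2.  Every set Z of at least kq points contains a member of
-- F: otherwise F lies among the k-sets not inside Z, so |F| ≤ C(n,k) - C(|Z|,k), whereas
-- C(n,k) - C(n-b,k) ≤ b C(n,k-1) ≤ b (2kq)^(k-1) ≤ q^k ≤ C(|Z|,k) for s large, and 𝓔(k,n,b)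
-- contains all C(n-b,k) k-subsets of [b+1,n].  Fewer than |B| disjoint k-sets miss more than kq
-- points, so the covering matching extends greedily to exactly |B| sets, contradicting that B
-- is blocking.

import Algebra.Properties.CommutativeSemigroup as CommSemigroupProperties
open import Data.Bool.Properties using (T-≡; T-∧)
open import Data.Fin as Fin using (Fin; toℕ)
open import Data.Fin.Properties using (toℕ<n)
open import Data.Fin.Subset
  using (Subset; ∣_∣; _⊆_; _∈_; _∉_; inside; outside; ⊤; _∪_; _∩_; ∁; ⋃; Nonempty)
open import Data.Fin.Subset.Properties
  using (_⊆?_; drop-∷-⊆; out⊆; in⊆in; ⊆⊤; ∣⊤∣≡n; ∣⊥∣≡0; ∣p∣≤∣x∷p∣; drop-there; ∉⊥; p⊆p∪q;
         q⊆p∪q; x∈p∪q⁻; x∈p∩q⁺; x∈p∩q⁻; x∈∁p⇒x∉p; p⊂q⇒∣p∣<∣q∣; ∣∁p∣≡n∸∣p∣; nonempty?; ∣p∩q∣≤∣p∣)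
open import Data.List using (List; []; _∷_; length; map; _++_; filter)
open import Data.List.Properties using (filter-++; length-++; filter-≐; filter-none; length-removeAt′)
open import Data.List.Membership.Propositional using (find) renaming (_∈_ to _∈ₗ_)
open import Data.List.Membership.Propositional.Properties using (∈-map⁺; ∈-++⁺ˡ; ∈-++⁺ʳ; ∈-filter⁺)
open import Data.List.Relation.Binary.Sublist.Propositional using (⊆-refl)
import Data.List.Relation.Binary.Sublist.Propositional.Properties as Sublist
open import Data.List.Relation.Unary.All as All using (All; []; _∷_)
import Data.List.Relation.Unary.All.Properties as All
open import Data.List.Relation.Unary.AllPairs using (AllPairs; []; _∷_)
import Data.List.Relation.Unary.AllPairs.Properties as AllPairs
open import Data.List.Relation.Unary.Any as Any using (Any; here; there; _─_; any?)
open import Data.List.Relation.Unary.Unique.Propositional using (Unique)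
open import Data.Nat using (ℕ; zero; suc; _+_; _*_; _∸_; _^_; _≤_; _<_; z≤n; s≤s; s≤s⁻¹; _≤′_; ≤′-refl; ≤′-step)
open import Data.Nat.Combinatorics using (_C_; nCk+nC[k+1]≡[n+1]C[k+1])
open import Data.Nat.Properties
open import Data.Product using (∃; _×_; _,_; proj₁; proj₂)
open import Data.Sum using (inj₁; inj₂)
open import Data.Vec as Vec using ([]; _∷_)
open import Data.Vec.Properties using (lookup⇒[]=; lookup∘tabulate)
open import Defs
open import Function using (_∘_; id; case_of_; Equivalence)
open import Relation.Binary.PropositionalEquality
  using (_≡_; _≢_; refl; sym; trans; cong; cong₂; subst; module ≡-Reasoning)
open import Relation.Nullary using (¬_; yes; no; contradiction)
open import Relation.Nullary.Decidable using (_×-dec_)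
open import Relation.Unary using (Pred; Decidable)
open import Relation.Unary.Properties using (_∩?_; ∁?)

^-distrib-* : ∀ a b o → (a * b) ^ o ≡ a ^ o * b ^ o
^-distrib-* a b zero    = refl
^-distrib-* a b (suc o) = trans (cong (a * b *_) (^-distrib-* a b o)) (interchange a b (a ^ o) (b ^ o))
  where open CommSemigroupProperties *-commutativeSemigroup using (interchange)

nCk≤[1+n]Ck : ∀ n k → n C k ≤ suc n C k
nCk≤[1+n]Ck n zero    = ≤-refl
nCk≤[1+n]Ck n (suc k) = begin
  n C suc k           ≤⟨ m≤n+m (n C suc k) (n C k) ⟩
  n C k + n C suc k   ≡⟨ nCk+nC[k+1]≡[n+1]C[k+1] n k ⟩
  suc n C suc k       ∎
  where open ≤-Reasoning

C-monoˡ-≤ : ∀ k {m n} → m ≤ n → m C k ≤ n C k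
C-monoˡ-≤ k m≤n = go (≤⇒≤′ m≤n)
  where
  go : ∀ {m n} → m ≤′ n → m C k ≤ n C k
  go ≤′-refl      = ≤-refl
  go (≤′-step le) = ≤-trans (go le) (nCk≤[1+n]Ck _ k)

nCk≤n^k : ∀ n k → n C k ≤ n ^ k
nCk≤n^k n       zero    = ≤-refl
nCk≤n^k zero    (suc k) = z≤n
nCk≤n^k (suc n) (suc k) = begin
  suc n C suc k               ≡⟨ nCk+nC[k+1]≡[n+1]C[k+1] n k ⟨
  n C k + n C suc k           ≤⟨ +-mono-≤ (nCk≤n^k n k) (nCk≤n^k n (suc k)) ⟩
  n ^ k + n * n ^ k           ≤⟨ +-monoʳ-≤ (n ^ k) (*-monoʳ-≤ n (^-monoˡ-≤ k (n≤1+n n))) ⟩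
  n ^ k + n * suc n ^ k       ≤⟨ +-monoˡ-≤ (n * suc n ^ k) (^-monoˡ-≤ k (n≤1+n n)) ⟩
  suc n ^ k + n * suc n ^ k   ∎
  where open ≤-Reasoning

-- A (1+j)-set meeting the b new points is one of them together with j further points.
[b+m]C[1+j]≤mC[1+j]+b*[b+m]Cj : ∀ b m j → (b + m) C suc j ≤ m C suc j + b * ((b + m) C j)
[b+m]C[1+j]≤mC[1+j]+b*[b+m]Cj zero    m j = m≤m+n (m C suc j) 0
[b+m]C[1+j]≤mC[1+j]+b*[b+m]Cj (suc b) m j = begin
  suc (b + m) C suc j                             ≡⟨ nCk+nC[k+1]≡[n+1]C[k+1] (b + m) j ⟨
  (b + m) C j + (b + m) C suc j                   ≤⟨ +-monoʳ-≤ ((b + m) C j) ([b+m]C[1+j]≤mC[1+j]+b*[b+m]Cj b m j) ⟩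
  (b + m) C j + (m C suc j + b * ((b + m) C j))   ≡⟨ x∙yz≈y∙xz ((b + m) C j) (m C suc j) _ ⟩
  m C suc j + ((b + m) C j + b * ((b + m) C j))   ≤⟨ +-monoʳ-≤ (m C suc j) (*-monoʳ-≤ (suc b) (nCk≤[1+n]Ck (b + m) j)) ⟩
  m C suc j + suc b * (suc (b + m) C j)           ∎
  where
  open ≤-Reasoning
  open CommSemigroupProperties +-commutativeSemigroup using (x∙yz≈y∙xz)

q*nCk≤[q+n]C[1+k] : ∀ q n k → q * (n C k) ≤ (q + n) C suc k
q*nCk≤[q+n]C[1+k] zero    n k = z≤n
q*nCk≤[q+n]C[1+k] (suc q) n k = begin
  n C k + q * (n C k)               ≤⟨ +-mono-≤ (C-monoˡ-≤ k (m≤n+m n q)) (q*nCk≤[q+n]C[1+k] q n k) ⟩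
  (q + n) C k + (q + n) C suc k     ≡⟨ nCk+nC[k+1]≡[n+1]C[k+1] (q + n) k ⟩
  suc (q + n) C suc k               ∎
  where open ≤-Reasoning

k*q≤n⇒q^k≤nCk : ∀ k q n → k * q ≤ n → q ^ k ≤ n C k
k*q≤n⇒q^k≤nCk zero    q n _      = ≤-refl
k*q≤n⇒q^k≤nCk (suc k) q n kq≤n = begin
  q * q ^ k                 ≤⟨ *-monoʳ-≤ q (k*q≤n⇒q^k≤nCk k q (k * q) ≤-refl) ⟩
  q * ((k * q) C k)         ≤⟨ q*nCk≤[q+n]C[1+k] q (k * q) k ⟩
  (q + k * q) C suc k       ≤⟨ C-monoˡ-≤ (suc k) kq≤n ⟩
  n C suc k                 ∎
  where open ≤-Reasoning

nC[1+j]≤[n∸b]C[1+j]+zC[1+j] : ∀ {K b q n z} j → b ≤ n → n ≤ K * q → b * K ^ j ≤ q → suc j * q ≤ z →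
                              n C suc j ≤ (n ∸ b) C suc j + z C suc j
nC[1+j]≤[n∸b]C[1+j]+zC[1+j] {K} {b} {q} {n} {z} j b≤n n≤Kq bKʲ≤q kq≤z = begin
  n C suc j                                  ≡⟨ cong (_C suc j) (m+[n∸m]≡n b≤n) ⟨
  (b + (n ∸ b)) C suc j                      ≤⟨ [b+m]C[1+j]≤mC[1+j]+b*[b+m]Cj b (n ∸ b) j ⟩
  (n ∸ b) C suc j + b * ((b + (n ∸ b)) C j)  ≡⟨ cong (λ m → (n ∸ b) C suc j + b * (m C j)) (m+[n∸m]≡n b≤n) ⟩
  (n ∸ b) C suc j + b * (n C j)              ≤⟨ +-monoʳ-≤ ((n ∸ b) C suc j) lost≤ ⟩
  (n ∸ b) C suc j + z C suc j                ∎
  where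
  open ≤-Reasoning
  lost≤ : b * (n C j) ≤ z C suc j
  lost≤ = begin
    b * (n C j)           ≤⟨ *-monoʳ-≤ b (≤-trans (nCk≤n^k n j) (^-monoˡ-≤ j n≤Kq)) ⟩
    b * (K * q) ^ j       ≡⟨ cong (b *_) (^-distrib-* K q j) ⟩
    b * (K ^ j * q ^ j)   ≡⟨ *-assoc b (K ^ j) (q ^ j) ⟨
    b * K ^ j * q ^ j     ≤⟨ *-monoˡ-≤ (q ^ j) bKʲ≤q ⟩
    q * q ^ j             ≤⟨ k*q≤n⇒q^k≤nCk (suc j) q z kq≤z ⟩
    z C suc j             ∎

module _ {a p q} {A : Set a} {P : Pred A p} {Q : Pred A q} (P? : Decidable P) (Q? : Decidable Q) where

  length-filter-mono : (∀ {x} → P x → Q x) → ∀ xs → length (filter P? xs) ≤ length (filter Q? xs)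
  length-filter-mono P⇒Q xs = Sublist.length-mono-≤ (Sublist.filter⁺ P? Q? (λ { refl → P⇒Q }) (⊆-refl {x = xs}))

  length-filter-≐ : (∀ {x} → P x → Q x) → (∀ {x} → Q x → P x) → ∀ xs → length (filter P? xs) ≡ length (filter Q? xs)
  length-filter-≐ P⇒Q Q⇒P xs = cong length (filter-≐ P? Q? (P⇒Q , Q⇒P) xs)

  length-filter-split : ∀ xs → length (filter P? xs) ≡ length (filter (P? ∩? Q?) xs) + length (filter (P? ∩? ∁? Q?) xs)
  length-filter-split []       = refl
  length-filter-split (x ∷ xs) with P? x | Q? x
  ... | yes _ | yes _ = cong suc (length-filter-split xs)
  ... | yes _ | no  _ = trans (cong suc (length-filter-split xs)) (sym (+-suc _ _))
  ... | no  _ | yes _ = length-filter-split xs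
  ... | no  _ | no  _ = length-filter-split xs

module _ {a b p} {A : Set a} {B : Set b} {P : Pred A p} (P? : Decidable P) where

  length-filter-map : ∀ (f : B → A) xs → length (filter P? (map f xs)) ≡ length (filter (P? ∘ f) xs)
  length-filter-map f []       = refl
  length-filter-map f (x ∷ xs) with P? (f x)
  ... | yes _ = cong suc (length-filter-map f xs)
  ... | no  _ = length-filter-map f xs

module _ {a p} {A : Set a} {P : Pred A p} (P? : Decidable P) where

  length-filter-++ : ∀ xs ys → length (filter P? (xs ++ ys)) ≡ length (filter P? xs) + length (filter P? ys)
  length-filter-++ xs ys = trans (cong length (filter-++ P? xs ys)) (length-++ (filter P? xs))

module _ {a} {A : Set a} where

  ∈-─ : ∀ {x y : A} {ys} (x∈ys : x ∈ₗ ys) → y ∈ₗ ys → y ≢ x → y ∈ₗ (ys ─ x∈ys)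
  ∈-─ (here refl)  (here refl)  y≢x = contradiction refl y≢x
  ∈-─ (here refl)  (there y∈ys) _   = y∈ys
  ∈-─ (there x∈ys) (here refl)  _   = here refl
  ∈-─ (there x∈ys) (there y∈ys) y≢x = there (∈-─ x∈ys y∈ys y≢x)

  Unique⇒length≤ : ∀ {xs ys : List A} → Unique xs → All (_∈ₗ ys) xs → length xs ≤ length ys
  Unique⇒length≤ {[]}             _               _                = z≤n
  Unique⇒length≤ {x ∷ xs} {ys} (x≢xs ∷ uniq) (x∈ys ∷ xs⊆ys) = begin
    suc (length xs)            ≤⟨ s≤s (Unique⇒length≤ uniq xs⊆ys─x) ⟩
    suc (length (ys ─ x∈ys))   ≡⟨ length-removeAt′ ys (Any.index x∈ys) ⟨
    length ys                  ∎
    where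
    open ≤-Reasoning
    xs⊆ys─x : All (_∈ₗ (ys ─ x∈ys)) xs
    xs⊆ys─x = All.zipWith (λ (y∈ys , x≢y) → ∈-─ x∈ys y∈ys (x≢y ∘ sym)) (xs⊆ys , x≢xs)

module _ {n : ℕ} where

  SubsetOfSize : ℕ → Subset n → Pred (Subset n) _
  SubsetOfSize k Z T = T ⊆ Z × ∣ T ∣ ≡ k

  subsetOfSize? : ∀ k Z → Decidable (SubsetOfSize k Z)
  subsetOfSize? k Z T = T ⊆? Z ×-dec ∣ T ∣ ≟ k

∈-allSubsets : ∀ {n} (T : Subset n) → T ∈ₗ allSubsets n
∈-allSubsets []            = here refl
∈-allSubsets (outside ∷ T) = ∈-++⁺ˡ (∈-map⁺ (outside ∷_) (∈-allSubsets T))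
∈-allSubsets (inside ∷ T)  = ∈-++⁺ʳ (map (outside ∷_) (allSubsets _)) (∈-map⁺ (inside ∷_) (∈-allSubsets T))

count-SubsetOfSize : ∀ {n} k (Z : Subset n) → length (filter (subsetOfSize? k Z) (allSubsets n)) ≡ ∣ Z ∣ C k
count-SubsetOfSize zero    []      = refl
count-SubsetOfSize (suc k) []      = refl
count-SubsetOfSize {suc n} k (z ∷ Z) = begin
  length (filter P? (map (outside ∷_) S ++ map (inside ∷_) S))
    ≡⟨ length-filter-++ P? (map (outside ∷_) S) (map (inside ∷_) S) ⟩
  length (filter P? (map (outside ∷_) S)) + length (filter P? (map (inside ∷_) S))
    ≡⟨ cong₂ _+_ (length-filter-map P? (outside ∷_) S) (length-filter-map P? (inside ∷_) S) ⟩
  length (filter (P? ∘ (outside ∷_)) S) + length (filter (P? ∘ (inside ∷_)) S)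
    ≡⟨ cong (_+ length (filter (P? ∘ (inside ∷_)) S)) excludingFirst ⟩
  ∣ Z ∣ C k + length (filter (P? ∘ (inside ∷_)) S)
    ≡⟨ includingFirst z k ⟩
  ∣ z ∷ Z ∣ C k ∎
  where
  open ≡-Reasoning
  S = allSubsets n
  P? = subsetOfSize? k (z ∷ Z)

  excludingFirst : length (filter (P? ∘ (outside ∷_)) S) ≡ ∣ Z ∣ C k
  excludingFirst = trans
    (length-filter-≐ (P? ∘ (outside ∷_)) (subsetOfSize? k Z)
       (λ (T⊆ , ∣T∣≡k) → drop-∷-⊆ T⊆ , ∣T∣≡k) (λ (T⊆ , ∣T∣≡k) → out⊆ T⊆ , ∣T∣≡k) S)
    (count-SubsetOfSize k Z)

  includingFirst : ∀ z k → ∣ Z ∣ C k + length (filter (subsetOfSize? k (z ∷ Z) ∘ (inside ∷_)) S) ≡ ∣ z ∷ Z ∣ C k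
  includingFirst outside k = begin
    ∣ Z ∣ C k + length (filter Q? S)   ≡⟨ cong (λ T → ∣ Z ∣ C k + length T) (filter-none Q? (All.universal none S)) ⟩
    ∣ Z ∣ C k + 0                      ≡⟨ +-identityʳ (∣ Z ∣ C k) ⟩
    ∣ Z ∣ C k                          ∎
    where
    Q? = subsetOfSize? k (outside ∷ Z) ∘ (inside ∷_)
    none : ∀ T → ¬ SubsetOfSize k (outside ∷ Z) (inside ∷ T)
    none _ (T⊆ , _) = case T⊆ Vec.here of λ ()
  includingFirst inside zero = cong (1 +_) (cong length (filter-none Q? (All.universal none S)))
    where
    Q? = subsetOfSize? zero (inside ∷ Z) ∘ (inside ∷_)
    none : ∀ T → ¬ SubsetOfSize zero (inside ∷ Z) (inside ∷ T)
    none _ (_ , ())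
  includingFirst inside (suc k) = begin
    ∣ Z ∣ C suc k + length (filter Q? S)   ≡⟨ cong (∣ Z ∣ C suc k +_) (trans Q≐ (count-SubsetOfSize k Z)) ⟩
    ∣ Z ∣ C suc k + ∣ Z ∣ C k              ≡⟨ +-comm (∣ Z ∣ C suc k) (∣ Z ∣ C k) ⟩
    ∣ Z ∣ C k + ∣ Z ∣ C suc k              ≡⟨ nCk+nC[k+1]≡[n+1]C[k+1] ∣ Z ∣ k ⟩
    suc ∣ Z ∣ C suc k                      ∎
    where
    Q? = subsetOfSize? (suc k) (inside ∷ Z) ∘ (inside ∷_)
    Q≐ : length (filter Q? S) ≡ length (filter (subsetOfSize? k Z) S)
    Q≐ = length-filter-≐ Q? (subsetOfSize? k Z)
           (λ (T⊆ , ∣T∣≡k) → drop-∷-⊆ T⊆ , suc-injective ∣T∣≡k) (λ (T⊆ , ∣T∣≡k) → in⊆in T⊆ , cong suc ∣T∣≡k) S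

length+∣Z∣Ck≤nCk : ∀ {n k} {F : List (Subset n)} (Z : Subset n) → Unique F → All (λ A → ∣ A ∣ ≡ k) F →
                   ¬ Any (_⊆ Z) F → length F + ∣ Z ∣ C k ≤ n C k
length+∣Z∣Ck≤nCk {n} {k} {F} Z uniq sizes F⊈Z = begin
  length F + ∣ Z ∣ C k                                       ≤⟨ +-monoˡ-≤ (∣ Z ∣ C k) F≤outside ⟩
  length (filter (P? ∩? ∁? Q?) S) + ∣ Z ∣ C k                ≡⟨ +-comm _ (∣ Z ∣ C k) ⟩
  ∣ Z ∣ C k + length (filter (P? ∩? ∁? Q?) S)                ≡⟨ cong (_+ length (filter (P? ∩? ∁? Q?) S)) inside≡ ⟨
  length (filter (P? ∩? Q?) S) + length (filter (P? ∩? ∁? Q?) S) ≡⟨ length-filter-split P? Q? S ⟨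
  length (filter P? S)                                       ≡⟨ count-SubsetOfSize k (⊤ {n}) ⟩
  ∣ ⊤ {n} ∣ C k                                              ≡⟨ cong (_C k) (∣⊤∣≡n n) ⟩
  n C k                                                      ∎
  where
  open ≤-Reasoning
  S = allSubsets n
  P? = subsetOfSize? k (⊤ {n})
  Q? = _⊆? Z
  inside≡ : length (filter (P? ∩? Q?) S) ≡ ∣ Z ∣ C k
  inside≡ = trans (length-filter-≐ (P? ∩? Q?) (subsetOfSize? k Z) (λ ((_ , ∣T∣≡k) , T⊆Z) → T⊆Z , ∣T∣≡k)
                                                                (λ (T⊆Z , ∣T∣≡k) → (⊆⊤ , ∣T∣≡k) , T⊆Z) S)
                  (count-SubsetOfSize k Z)
  F≤outside : length F ≤ length (filter (P? ∩? ∁? Q?) S)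
  F≤outside = Unique⇒length≤ uniq (All.zipWith
    (λ (∣A∣≡k , A⊈Z) → ∈-filter⁺ (P? ∩? ∁? Q?) (∈-allSubsets _) ((⊆⊤ , ∣A∣≡k) , A⊈Z))
    (sizes , All.¬Any⇒All¬ F F⊈Z))

n∸b≤∣p∣ : ∀ {n} b (p : Subset n) → (∀ x → b ≤ toℕ x → x ∈ p) → n ∸ b ≤ ∣ p ∣
n∸b≤∣p∣ zero    []            _       = z≤n
n∸b≤∣p∣ (suc b) []            _       = z≤n
n∸b≤∣p∣ zero    (outside ∷ p) ≥b⇒∈p = contradiction (≥b⇒∈p Fin.zero z≤n) λ ()
n∸b≤∣p∣ zero    (inside ∷ p)  ≥b⇒∈p = s≤s (n∸b≤∣p∣ zero p (λ x _ → drop-there (≥b⇒∈p (Fin.suc x) z≤n)))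
n∸b≤∣p∣ (suc b) (s ∷ p)       ≥b⇒∈p =
  ≤-trans (n∸b≤∣p∣ b p (λ x b≤x → drop-there (≥b⇒∈p (Fin.suc x) (s≤s b≤x)))) (∣p∣≤∣x∷p∣ s p)

module _ (k n b : ℕ) where
  open ExtremalFamily k n b

  n∸b≤∣Upper∣ : n ∸ b ≤ ∣ Upper ∣
  n∸b≤∣Upper∣ = n∸b≤∣p∣ b Upper λ x b≤x →
    lookup⇒[]= x Upper (trans (lookup∘tabulate _ x)
                             (Equivalence.to T-≡ (Equivalence.from T-∧ (≤⇒≤ᵇ b≤x , <⇒<ᵇ (toℕ<n x)))))

  [n∸b]Ck≤Ecard : (n ∸ b) C k ≤ Ecard k n b
  [n∸b]Ck≤Ecard = begin
    (n ∸ b) C k                                              ≤⟨ C-monoˡ-≤ k n∸b≤∣Upper∣ ⟩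
    ∣ Upper ∣ C k                                            ≡⟨ count-SubsetOfSize k Upper ⟨
    length (filter (subsetOfSize? k Upper) (allSubsets n))   ≤⟨ length-filter-mono (subsetOfSize? k Upper) InE? inj₁ (allSubsets n) ⟩
    Ecard k n b                                              ∎
    where open ≤-Reasoning

every-large-set-contains-member : ∀ {n j b K q} {F : List (Subset n)} →
  Unique F → All (λ A → ∣ A ∣ ≡ suc j) F → Ecard (suc j) n b < length F →
  b ≤ n → n ≤ K * q → b * K ^ j ≤ q → ∀ Z → suc j * q ≤ ∣ Z ∣ → Any (_⊆ Z) F
every-large-set-contains-member {n} {j} {b} {F = F} uniq sizes E<F b≤n n≤Kq bKʲ≤q Z kq≤z
  with any? (_⊆? Z) F
... | yes found = found
... | no  none  = contradiction E<F (≤⇒≯ (+-cancelʳ-≤ (∣ Z ∣ C k) (length F) (Ecard k n b) (begin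
  length F + ∣ Z ∣ C k            ≤⟨ length+∣Z∣Ck≤nCk Z uniq sizes none ⟩
  n C k                           ≤⟨ nC[1+j]≤[n∸b]C[1+j]+zC[1+j] j b≤n n≤Kq bKʲ≤q kq≤z ⟩
  (n ∸ b) C k + ∣ Z ∣ C k         ≤⟨ +-monoˡ-≤ (∣ Z ∣ C k) ([n∸b]Ck≤Ecard k n b) ⟩
  Ecard k n b + ∣ Z ∣ C k         ∎)))
  where
  open ≤-Reasoning
  k = suc j

∣p∪q∣≤∣p∣+∣q∣ : ∀ {n} (p q : Subset n) → ∣ p ∪ q ∣ ≤ ∣ p ∣ + ∣ q ∣
∣p∪q∣≤∣p∣+∣q∣ []            []            = z≤n
∣p∪q∣≤∣p∣+∣q∣ (outside ∷ p) (outside ∷ q) = ∣p∪q∣≤∣p∣+∣q∣ p q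
∣p∪q∣≤∣p∣+∣q∣ (outside ∷ p) (inside ∷ q)  = subst (suc ∣ p ∪ q ∣ ≤_) (sym (+-suc ∣ p ∣ ∣ q ∣)) (s≤s (∣p∪q∣≤∣p∣+∣q∣ p q))
∣p∪q∣≤∣p∣+∣q∣ (inside ∷ p)  (outside ∷ q) = s≤s (∣p∪q∣≤∣p∣+∣q∣ p q)
∣p∪q∣≤∣p∣+∣q∣ (inside ∷ p)  (inside ∷ q)  = s≤s (≤-trans (∣p∪q∣≤∣p∣+∣q∣ p q) (+-monoʳ-≤ ∣ p ∣ (n≤1+n ∣ q ∣)))

module _ {n : ℕ} where

  ⊆⋃ : ∀ {A : Subset n} {L} → A ∈ₗ L → A ⊆ ⋃ L
  ⊆⋃ {L = _ ∷ L} (here refl) = p⊆p∪q (⋃ L)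
  ⊆⋃ {L = D ∷ L} (there A∈L) = q⊆p∪q D (⋃ L) ∘ ⊆⋃ A∈L

  ∈⋃⁻ : ∀ {x : Fin n} L → x ∈ ⋃ L → Any (x ∈_) L
  ∈⋃⁻ []      x∈⋃L = contradiction x∈⋃L ∉⊥
  ∈⋃⁻ (A ∷ L) x∈⋃L with x∈p∪q⁻ A (⋃ L) x∈⋃L
  ... | inj₁ x∈A   = here x∈A
  ... | inj₂ x∈⋃L′ = there (∈⋃⁻ L x∈⋃L′)

  ∣⋃∣≤k*length : ∀ {k} (L : List (Subset n)) → All (λ A → ∣ A ∣ ≤ k) L → ∣ ⋃ L ∣ ≤ k * length L
  ∣⋃∣≤k*length {k} []      []               = ≤-reflexive (trans (∣⊥∣≡0 n) (sym (*-zeroʳ k)))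
  ∣⋃∣≤k*length {k} (A ∷ L) (∣A∣≤k ∷ sizes) = begin
    ∣ A ∪ ⋃ L ∣           ≤⟨ ∣p∪q∣≤∣p∣+∣q∣ A (⋃ L) ⟩
    ∣ A ∣ + ∣ ⋃ L ∣       ≤⟨ +-mono-≤ ∣A∣≤k (∣⋃∣≤k*length L sizes) ⟩
    k + k * length L      ≡⟨ *-suc k (length L) ⟨
    k * suc (length L)    ∎
    where open ≤-Reasoning

  ⊆∁⋃⇒Disjoint : ∀ {A : Subset n} L → A ⊆ ∁ (⋃ L) → All (Disjoint A) L
  ⊆∁⋃⇒Disjoint L A⊆∁⋃L = All.tabulate λ C∈L (x , x∈A∩C) →
    let x∈A , x∈C = x∈p∩q⁻ _ _ x∈A∩C in x∈∁p⇒x∉p (A⊆∁⋃L x∈A) (⊆⋃ C∈L x∈C)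

  length≤∣B∩⋃∣ : ∀ (B : Subset n) L → AllPairs Disjoint L → All (λ A → Nonempty (A ∩ B)) L → length L ≤ ∣ B ∩ ⋃ L ∣
  length≤∣B∩⋃∣ B []      _                _                       = z≤n
  length≤∣B∩⋃∣ B (A ∷ L) (A#L ∷ disjoint) ((x , x∈A∩B) ∷ meetB) =
    ≤-trans (s≤s (length≤∣B∩⋃∣ B L disjoint meetB)) (p⊂q⇒∣p∣<∣q∣ (B∩⋃L⊆ , x , x∈B∩[A∪⋃L] , x∉B∩⋃L))
    where
    x∈A = proj₁ (x∈p∩q⁻ A B x∈A∩B)
    x∈B = proj₂ (x∈p∩q⁻ A B x∈A∩B)
    B∩⋃L⊆ : B ∩ ⋃ L ⊆ B ∩ (A ∪ ⋃ L)
    B∩⋃L⊆ y∈ = let y∈B , y∈⋃L = x∈p∩q⁻ B (⋃ L) y∈ in x∈p∩q⁺ (y∈B , q⊆p∪q A (⋃ L) y∈⋃L)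
    x∈B∩[A∪⋃L] : x ∈ B ∩ (A ∪ ⋃ L)
    x∈B∩[A∪⋃L] = x∈p∩q⁺ (x∈B , p⊆p∪q (⋃ L) x∈A)
    x∉B∩⋃L : x ∉ B ∩ ⋃ L
    x∉B∩⋃L x∈B∩⋃L = All.All¬⇒¬Any (All.map (λ A#D x∈D → A#D (x , x∈p∩q⁺ (x∈A , x∈D))) A#L)
                                  (∈⋃⁻ L (proj₂ (x∈p∩q⁻ B (⋃ L) x∈B∩⋃L)))

module _ {n : ℕ} {F : List (Subset n)} where

  trimCover : ∀ {M} {B : Subset n} → IsMatching F M → Covers M B →
              ∃ λ M′ → IsMatching F M′ × length M′ ≤ ∣ B ∣ × Covers M′ B
  trimCover {M} {B} (M⊆F , disjoint) M⊇B = M′ , (All.filter⁺ meetsB? M⊆F , disjoint′) , M′≤B , M′⊇B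
    where
    meetsB? = λ (A : Subset n) → nonempty? (A ∩ B)
    M′ = filter meetsB? M
    disjoint′ : AllPairs Disjoint M′
    disjoint′ = AllPairs.filter⁺ meetsB? disjoint
    M′≤B : length M′ ≤ ∣ B ∣
    M′≤B = ≤-trans (length≤∣B∩⋃∣ B M′ disjoint′ (All.all-filter meetsB? M)) (∣p∩q∣≤∣p∣ B (⋃ M′))
    M′⊇B : Covers M′ B
    M′⊇B {x} x∈B = let A , A∈M , x∈A = find (∈⋃⁻ M (M⊇B x∈B)) in
      ⊆⋃ (∈-filter⁺ meetsB? A∈M (x , x∈p∩q⁺ (x∈A , x∈B))) x∈A

  module _ {k m : ℕ} (sizes : All (λ A → ∣ A ∣ ≤ k) F) (dense : ∀ Z → m ≤ ∣ Z ∣ → Any (_⊆ Z) F) where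

    growMatching : ∀ {L} → IsMatching F L → k * length L + m ≤ n → ∃ λ A → IsMatching F (A ∷ L)
    growMatching {L} (L⊆F , disjoint) room =
      let A , A∈F , A⊆Z = find (dense Z m≤∣Z∣) in A , (A∈F ∷ L⊆F , ⊆∁⋃⇒Disjoint L A⊆Z ∷ disjoint)
      where
      Z = ∁ (⋃ L)
      m≤∣Z∣ : m ≤ ∣ Z ∣
      m≤∣Z∣ = begin
        m                  ≤⟨ m+n≤o⇒m≤o∸n m (subst (_≤ n) (+-comm (k * length L) m) room) ⟩
        n ∸ k * length L   ≤⟨ ∸-monoʳ-≤ n (∣⋃∣≤k*length L (All.map (All.lookup sizes) L⊆F)) ⟩
        n ∸ ∣ ⋃ L ∣        ≡⟨ ∣∁p∣≡n∸∣p∣ (⋃ L) ⟨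
        ∣ Z ∣              ∎
        where open ≤-Reasoning

    extendMatching : ∀ T {L} → IsMatching F L → length L ≤ T → (∀ ℓ → ℓ < T → k * ℓ + m ≤ n) →
                     ∃ λ L′ → IsMatching F L′ × length L′ ≡ T × ⋃ L ⊆ ⋃ L′
    extendMatching zero    {[]} matching _ _ = [] , matching , refl , id
    extendMatching (suc T) {L} matching L≤1+T room with m≤n⇒m<n∨m≡n L≤1+T
    ... | inj₂ L≡1+T = L , matching , L≡1+T , id
    ... | inj₁ L<1+T =
      let L′ , matching′ , L′≡T , ⋃L⊆⋃L′ =
            extendMatching T matching (s≤s⁻¹ L<1+T) (λ ℓ ℓ<T → room ℓ (m<n⇒m<1+n ℓ<T))
          A , matching″ = growMatching matching′ (subst (λ ℓ → k * ℓ + m ≤ n) (sym L′≡T) (room T (n<1+n T)))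
      in A ∷ L′ , matching″ , cong suc L′≡T , q⊆p∪q A (⋃ L′) ∘ ⋃L⊆⋃L′

2*m≤n⇒n≤2*[n∸m] : ∀ {m n} → 2 * m ≤ n → n ≤ 2 * (n ∸ m)
2*m≤n⇒n≤2*[n∸m] {m} {n} 2m≤n = begin
  n                ≤⟨ m+n≤o⇒m≤o∸n n (+-monoʳ-≤ n 2m≤n) ⟩
  n + n ∸ 2 * m    ≡⟨ cong (_∸ 2 * m) (cong (n +_) (+-identityʳ n)) ⟨
  2 * n ∸ 2 * m    ≡⟨ *-distribˡ-∸ 2 n m ⟨
  2 * (n ∸ m)      ∎
  where open ≤-Reasoning

-- With M₀ = b (2k)^j and k = 1 + j, the threshold N = k · 2M₀ forces s ≥ 2M₀, so that
-- q = s - β ≥ s/2 meets the hypotheses of every-large-set-contains-member with K = 2k.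
threshold-bounds : ∀ {j b s β} → let k = suc j; M₀ = b * (2 * k) ^ j in
                   k * (2 * M₀) ≤ k * s → 2 * β ≤ s →
                   b ≤ k * s × k * s ≤ (2 * k) * (s ∸ β) × M₀ ≤ s ∸ β
threshold-bounds {j} {b} {s} {β} 2kM₀≤ks 2β≤s = b≤ks , ks≤2kq , M₀≤q
  where
  k = suc j
  q = s ∸ β
  s≤2q : s ≤ 2 * q
  s≤2q = 2*m≤n⇒n≤2*[n∸m] {β} 2β≤s
  M₀≤q : b * (2 * k) ^ j ≤ q
  M₀≤q = *-cancelˡ-≤ 2 (≤-trans (*-cancelˡ-≤ k 2kM₀≤ks) s≤2q)
  b≤ks : b ≤ k * s
  b≤ks = ≤-trans (m≤m*n b ((2 * k) ^ j) {{m^n≢0 (2 * k) j}})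
                 (≤-trans M₀≤q (≤-trans (m∸n≤m s β) (m≤n*m s k)))
  ks≤2kq : k * s ≤ (2 * k) * q
  ks≤2kq = ≤-trans (*-monoʳ-≤ k s≤2q) (≤-reflexive (trans (sym (*-assoc k 2 q)) (cong (_* q) (*-comm k 2))))

k*ℓ+k*[s∸β]≤k*s : ∀ k {ℓ β s} → ℓ ≤ β → β ≤ s → k * ℓ + k * (s ∸ β) ≤ k * s
k*ℓ+k*[s∸β]≤k*s k {ℓ} {β} {s} ℓ≤β β≤s = begin
  k * ℓ + k * (s ∸ β)   ≡⟨ *-distribˡ-+ k ℓ (s ∸ β) ⟨
  k * (ℓ + (s ∸ β))     ≤⟨ *-monoʳ-≤ k (+-monoˡ-≤ (s ∸ β) ℓ≤β) ⟩
  k * (β + (s ∸ β))     ≡⟨ cong (k *_) (m+[n∸m]≡n β≤s) ⟩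
  k * s                 ∎
  where open ≤-Reasoning

lemma2p4 : (k b : ℕ) → 2 ≤ k → 1 ≤ b →
    ∃ λ N → (s : ℕ) → 2 ≤ s → N ≤ k * s →
      (F : List (Subset (k * s))) → Unique F → All (λ A → ∣ A ∣ ≡ k) F →
      Ecard k (k * s) b < length F →
      (B : Subset (k * s)) → Blocking s F B → 2 * ∣ B ∣ ≤ s →
      ¬ (∃ λ M → IsMatching F M × Covers M B)
lemma2p4 zero    _ () _
lemma2p4 (suc j) b _  _ = suc j * (2 * (b * (2 * suc j) ^ j)) ,
  λ s _ N≤ks F uniq sizes E<F B (β≤s , noPerfectCover) 2β≤s (M , matching , covers) →
    let b≤n , n≤2kq , M₀≤q = threshold-bounds {j} {b} {s} {∣ B ∣} N≤ks 2β≤s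
        dense = every-large-set-contains-member uniq sizes E<F b≤n n≤2kq M₀≤q
        room = λ ℓ ℓ<β → k*ℓ+k*[s∸β]≤k*s (suc j) (<⇒≤ ℓ<β) β≤s
        M′ , matching′ , M′≤β , covers′ = trimCover matching covers
        L , matchingL , L≡β , ⋃M′⊆⋃L =
          extendMatching (All.map ≤-reflexive sizes) dense ∣ B ∣ matching′ M′≤β room
    in noPerfectCover (L , matchingL , L≡β , ⋃M′⊆⋃L ∘ covers′)
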